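{- Let $c>1$ be an integer. Then the following are equivalent: (i) $\operatorname{cosocle}(c-1)>\operatorname{rad}(c)$; (ii) $\operatorname{cosocle}(c)>\operatorname{rad}(c-1)$; (iii) $(1,c-1,c)$ is an $abc$ triple.
   Context: For a positive integer $n$, $\operatorname{rad}(n)$ denotes the product of the distinct prime factors of $n$ (with $\operatorname{rad}(1)=1$), and $\operatorname{cosocle}(n)=\frac{n}{\operatorname{rad}(n)}$. An $abc$ triple is a triple $(a,b,c)$ of relatively prime positive integers with $a+b=c$ and $\operatorname{rad}(abc)<c$. -}

module Defs where

open import Data.Nat using (ℕ; zero; suc; _+_; _*_; _<_; NonZero; _/_)
open import Data.Nat.Properties using (m*n≢0)
open import Data.Nat.Divisibility using (_∣_; _∣?_)
open import Data.Nat.Primality using (Prime; prime?; prime⇒nonZero)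
open import Data.Nat.Coprimality using (Coprime)
open import Data.Nat.ListAction using (product)
open import Data.List using (List; []; _∷_; filter; upTo)
open import Data.List.Relation.Unary.All using (All; []; _∷_)
open import Data.List.Relation.Unary.All.Properties using (all-filter)
open import Data.Product using (_×_)
open import Relation.Nullary.Decidable using (_×-dec_)

primeDivisors : ℕ → List ℕ
primeDivisors n = filter (λ p → prime? p ×-dec (p ∣? n)) (upTo (suc n))

-- rad n = product of the distinct prime factors of n (rad 1 = 1, rad 0 = 1).
rad : ℕ → ℕ
rad n = product (primeDivisors n)

private
  prodNZ : (xs : List ℕ) → All NonZero xs → NonZero (product xs)
  prodNZ [] [] = _
  prodNZ (x ∷ xs) (nx ∷ nxs) = m*n≢0 x (product xs) {{nx}} {{prodNZ xs nxs}}

  primesNZ : ∀ {n} (xs : List ℕ) → All NonZero (filter (λ p → prime? p ×-dec (p ∣? n)) xs)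
  primesNZ xs = Data.List.Relation.Unary.All.map (λ { (pp , _) → prime⇒nonZero pp }) (all-filter _ xs)
    where open import Data.Product using (_,_)

rad-nonZero : ∀ n → NonZero (rad n)
rad-nonZero n = prodNZ (primeDivisors n) (primesNZ {n} (upTo (suc n)))

cosocle : ℕ → ℕ
cosocle n = _/_ n (rad n) {{rad-nonZero n}}

IsAbcTriple : ℕ → ℕ → ℕ → Set
IsAbcTriple a b c =
  (0 < a × 0 < b × 0 < c) × (Coprime a b × Coprime a c × Coprime b c)
    × (a + b ≡ c) × (rad (a * b * c) < c)
  where open import Relation.Binary.PropositionalEquality using (_≡_)

-- Write b = c − 1. Since n = rad(n) cosocle(n), condition (i) says rad(b) rad(c) < b and
-- (ii) says rad(b) rad(c) < b + 1; as b and c are coprime, rad(bc) = rad(b) rad(c), so (iii)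
-- is again rad(b) rad(c) < c. The gap between (i) and (ii) closes because rad(b) rad(c) ≠ b:
-- otherwise rad(c) divides both b and b + 1, forcing rad(c) = 1, which is impossible for c > 1.
module Submission where

open import Defs
open import Data.Nat using (ℕ; _<_; _>_; _∸_)
open import Data.Product using (_×_)
open import Function.Bundles using (_⇔_)

open import Data.Nat using (zero; suc; _+_; _*_; NonZero; >-nonZero⁻¹; s≤s; z<s)
open import Data.Nat.Properties
open import Algebra.Properties.CommutativeSemigroup *-commutativeSemigroup using (xy∙z≈xz∙y)
open import Data.Nat.Divisibility
open import Data.Nat.DivMod using (m*[n/m]≡n)
open import Data.Nat.Primality
open import Data.Nat.Primality.Factorisation using (factorise)
open import Data.Nat.Coprimality using (Coprime; coprime-divisor; coprime-+; 1-coprimeTo)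
import Data.Nat.Coprimality as Coprime
open import Data.Nat.ListAction using (product)
open import Data.Nat.ListAction.Properties using (product-++)
open import Data.List using ([]; _∷_; filter; upTo; _++_)
open import Data.List.Properties using (upTo-∷ʳ; filter-++; filter-accept; filter-reject)
open import Data.List.Relation.Unary.All using (_∷_)
open import Data.Product using (_,_)
open import Data.Empty using (⊥-elim)
open import Data.Sum using (inj₁; inj₂)
open import Function using (_∘′_)
open import Function.Bundles using (mk⇔)
import Function.Properties.Equivalence as ⇔
open import Relation.Nullary using (¬_; yes; no; Dec; contradiction)
open import Relation.Nullary.Decidable using (_×-dec_)
open import Relation.Binary.PropositionalEquality

IsPrimeDivisor : ℕ → ℕ → Set
IsPrimeDivisor n p = Prime p × p ∣ n

isPrimeDivisor? : ∀ n p → Dec (IsPrimeDivisor n p)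
isPrimeDivisor? n p = prime? p ×-dec (p ∣? n)

-- The product of the prime divisors of n below m, so that rad n = radBelow n (suc n)
-- holds by definition.
radBelow : ℕ → ℕ → ℕ
radBelow n m = product (filter (isPrimeDivisor? n) (upTo m))

radBelow-suc : ∀ n m →
  radBelow n (suc m) ≡ radBelow n m * product (filter (isPrimeDivisor? n) (m ∷ []))
radBelow-suc n m = begin
    product (filter P (upTo (suc m)))
  ≡⟨ cong (product ∘′ filter P) (sym (upTo-∷ʳ m)) ⟩
    product (filter P (upTo m ++ m ∷ []))
  ≡⟨ cong product (filter-++ P (upTo m) (m ∷ [])) ⟩
    product (filter P (upTo m) ++ filter P (m ∷ []))
  ≡⟨ product-++ (filter P (upTo m)) (filter P (m ∷ [])) ⟩
    radBelow n m * product (filter P (m ∷ [])) ∎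
  where
  open ≡-Reasoning
  P = isPrimeDivisor? n

radBelow-suc-accept : ∀ {n m} → IsPrimeDivisor n m → radBelow n (suc m) ≡ radBelow n m * m
radBelow-suc-accept {n} {m} pm = trans (radBelow-suc n m) (trans
  (cong (λ xs → radBelow n m * product xs) (filter-accept (isPrimeDivisor? n) {xs = []} pm))
  (cong (radBelow n m *_) (*-identityʳ m)))

radBelow-suc-reject : ∀ {n m} → ¬ IsPrimeDivisor n m → radBelow n (suc m) ≡ radBelow n m
radBelow-suc-reject {n} {m} ¬pm = trans (radBelow-suc n m) (trans
  (cong (λ xs → radBelow n m * product xs) (filter-reject (isPrimeDivisor? n) {xs = []} ¬pm))
  (*-identityʳ _))

prime∣radBelow⇒< : ∀ {n d} m → Prime d → d ∣ radBelow n m → d < m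
prime∣radBelow⇒< zero pd d∣1 = contradiction (subst Prime (∣1⇒≡1 d∣1) pd) ¬prime[1]
prime∣radBelow⇒< {n} {d} (suc m) pd d∣ with isPrimeDivisor? n m
... | no ¬pm = m<n⇒m<1+n (prime∣radBelow⇒< m pd (subst (d ∣_) (radBelow-suc-reject ¬pm) d∣))
... | yes pm@(pm-prime , _)
  with euclidsLemma (radBelow n m) m pd (subst (d ∣_) (radBelow-suc-accept pm) d∣)
...   | inj₁ d∣r = m<n⇒m<1+n (prime∣radBelow⇒< m pd d∣r)
...   | inj₂ d∣m = s≤s (∣⇒≤ {{prime⇒nonZero pm-prime}} d∣m)

radBelow∣n : ∀ n .{{_ : NonZero n}} m → radBelow n m ∣ n
radBelow∣n n zero = 1∣ n
radBelow∣n n (suc m) with isPrimeDivisor? n m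
... | no ¬pm = subst (_∣ n) (sym (radBelow-suc-reject ¬pm)) (radBelow∣n n m)
... | yes pm@(pm-prime , divides q n≡q*m) =
  subst (_∣ n) (sym (radBelow-suc-accept pm))
    (subst (radBelow n m * m ∣_) (sym n≡q*m) (*-monoˡ-∣ m r∣q))
  where
  -- Every prime factor of radBelow n m is smaller than the prime m.
  r⊥m : Coprime (radBelow n m) m
  r⊥m {i} (i∣r , i∣m) with prime⇒irreducible pm-prime i∣m
  ... | inj₁ i≡1 = i≡1
  ... | inj₂ refl = contradiction (prime∣radBelow⇒< m pm-prime i∣r) (<-irrefl refl)
  r∣q : radBelow n m ∣ q
  r∣q = coprime-divisor r⊥m (subst (radBelow n m ∣_) (trans n≡q*m (*-comm q m)) (radBelow∣n n m))

prime∣⇒∣radBelow : ∀ {n p} m → Prime p → p ∣ n → p < m → p ∣ radBelow n m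
prime∣⇒∣radBelow {n} {p} (suc m) pp p∣n p<1+m with isPrimeDivisor? n m | m<1+n⇒m<n∨m≡n p<1+m
... | yes pm  | inj₁ p<m  = subst (p ∣_) (sym (radBelow-suc-accept pm))
                              (∣-trans (prime∣⇒∣radBelow m pp p∣n p<m) (m∣m*n m))
... | yes pm  | inj₂ refl = subst (p ∣_) (sym (radBelow-suc-accept pm)) (n∣m*n (radBelow n m))
... | no ¬pm  | inj₁ p<m  = subst (p ∣_) (sym (radBelow-suc-reject ¬pm)) (prime∣⇒∣radBelow m pp p∣n p<m)
... | no ¬pm  | inj₂ refl = contradiction (pp , p∣n) ¬pm

radBelow-* : ∀ {b c} → Coprime b c → ∀ m → radBelow (b * c) m ≡ radBelow b m * radBelow c m
radBelow-* b⊥c zero = refl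
radBelow-* {b} {c} b⊥c (suc m) with isPrimeDivisor? b m | isPrimeDivisor? c m
... | yes (pm , m∣b) | yes (_ , m∣c) = ⊥-elim (¬prime[1] (subst Prime (b⊥c (m∣b , m∣c)) pm))
... | yes b-pm@(pm , m∣b) | no ¬c-pm = begin
    radBelow (b * c) (suc m)          ≡⟨ radBelow-suc-accept (pm , ∣-trans m∣b (m∣m*n c)) ⟩
    radBelow (b * c) m * m            ≡⟨ cong (_* m) (radBelow-* b⊥c m) ⟩
    radBelow b m * radBelow c m * m   ≡⟨ xy∙z≈xz∙y (radBelow b m) (radBelow c m) m ⟩
    radBelow b m * m * radBelow c m   ≡⟨ cong₂ _*_ (radBelow-suc-accept b-pm) (radBelow-suc-reject ¬c-pm) ⟨
    radBelow b (suc m) * radBelow c (suc m) ∎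
  where open ≡-Reasoning
... | no ¬b-pm | yes c-pm@(pm , m∣c) = begin
    radBelow (b * c) (suc m)          ≡⟨ radBelow-suc-accept (pm , ∣-trans m∣c (n∣m*n b)) ⟩
    radBelow (b * c) m * m            ≡⟨ cong (_* m) (radBelow-* b⊥c m) ⟩
    radBelow b m * radBelow c m * m   ≡⟨ *-assoc (radBelow b m) (radBelow c m) m ⟩
    radBelow b m * (radBelow c m * m) ≡⟨ cong₂ _*_ (radBelow-suc-reject ¬b-pm) (radBelow-suc-accept c-pm) ⟨
    radBelow b (suc m) * radBelow c (suc m) ∎
  where open ≡-Reasoning
... | no ¬b-pm | no ¬c-pm = begin
    radBelow (b * c) (suc m)          ≡⟨ radBelow-suc-reject ¬bc-pm ⟩
    radBelow (b * c) m                ≡⟨ radBelow-* b⊥c m ⟩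
    radBelow b m * radBelow c m       ≡⟨ cong₂ _*_ (radBelow-suc-reject ¬b-pm) (radBelow-suc-reject ¬c-pm) ⟨
    radBelow b (suc m) * radBelow c (suc m) ∎
  where
  open ≡-Reasoning
  ¬bc-pm : ¬ IsPrimeDivisor (b * c) m
  ¬bc-pm (pm , m∣bc) with euclidsLemma b c pm m∣bc
  ... | inj₁ m∣b = ¬b-pm (pm , m∣b)
  ... | inj₂ m∣c = ¬c-pm (pm , m∣c)

radBelow-stable : ∀ {n} .{{_ : NonZero n}} m → n < m → radBelow n m ≡ rad n
radBelow-stable {n} (suc m) n<1+m with m<1+n⇒m<n∨m≡n n<1+m
... | inj₂ refl = refl
... | inj₁ n<m  = trans (radBelow-suc-reject ¬pm) (radBelow-stable m n<m)
  where
  ¬pm : ¬ IsPrimeDivisor n m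
  ¬pm (_ , m∣n) = <⇒≱ n<m (∣⇒≤ m∣n)

rad-* : ∀ {b c} .{{_ : NonZero b}} .{{_ : NonZero c}} → Coprime b c → rad (b * c) ≡ rad b * rad c
rad-* {b} {c} b⊥c = trans (radBelow-* b⊥c (suc (b * c)))
  (cong₂ _*_ (radBelow-stable _ (s≤s (m≤m*n b c))) (radBelow-stable _ (s≤s (m≤n*m c b))))

rad∣n : ∀ n .{{_ : NonZero n}} → rad n ∣ n
rad∣n n = radBelow∣n n (suc n)

prime∣⇒∣rad : ∀ {n p} .{{_ : NonZero n}} → Prime p → p ∣ n → p ∣ rad n
prime∣⇒∣rad pp p∣n = prime∣⇒∣radBelow _ pp p∣n (s≤s (∣⇒≤ p∣n))

rad≢1 : ∀ {n} → 1 < n → rad n ≢ 1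
rad≢1 {n} (s≤s (s≤s _)) rad≡1 with factorise n
... | record { factors = [] ; isFactorisation = () }
... | record { factors = p ∷ ps ; isFactorisation = n≡∏ ; factorsPrime = pp ∷ _ } =
  ¬prime[1] (subst Prime (∣1⇒≡1 (subst (p ∣_) rad≡1 (prime∣⇒∣rad pp p∣n))) pp)
  where
  p∣n : p ∣ n
  p∣n = subst (p ∣_) (sym n≡∏) (m∣m*n (product ps))

rad*cosocle≡n : ∀ n .{{_ : NonZero n}} → rad n * cosocle n ≡ n
rad*cosocle≡n n = m*[n/m]≡n {{rad-nonZero n}} (rad∣n n)

<cosocle⇔rad*< : ∀ n .{{_ : NonZero n}} k → k < cosocle n ⇔ rad n * k < n
<cosocle⇔rad*< n k = mk⇔
  (λ k<q → subst (rad n * k <_) (rad*cosocle≡n n) (*-monoʳ-< (rad n) {{rad-nonZero n}} k<q))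
  (λ rk<n → *-cancelˡ-< (rad n) k _ (subst (rad n * k <_) (sym (rad*cosocle≡n n)) rk<n))

coprime-suc : ∀ n → Coprime n (suc n)
coprime-suc n = subst (Coprime n) (+-comm n 1) (Coprime.sym (coprime-+ (1-coprimeTo n)))

rad*rad[1+n]≢n : ∀ n .{{_ : NonZero n}} → rad n * rad (suc n) ≢ n
rad*rad[1+n]≢n n eq = rad≢1 (s≤s (>-nonZero⁻¹ n)) (∣1⇒≡1 (∣m+n∣m⇒∣n r∣n+1 r∣n))
  where
  r∣n : rad (suc n) ∣ n
  r∣n = subst (rad (suc n) ∣_) eq (n∣m*n (rad n))
  r∣n+1 : rad (suc n) ∣ n + 1
  r∣n+1 = subst (rad (suc n) ∣_) (+-comm 1 n) (rad∣n (suc n))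

isAbcTriple[1,n,1+n]⇔ : ∀ n .{{_ : NonZero n}} → IsAbcTriple 1 n (suc n) ⇔ rad n * rad (suc n) < suc n
isAbcTriple[1,n,1+n]⇔ n = mk⇔ (λ (_ , _ , _ , r<c) → subst (_< suc n) rad[1*n*c]≡ r<c) abc
  where
  rad[1*n*c]≡ : rad (1 * n * suc n) ≡ rad n * rad (suc n)
  rad[1*n*c]≡ = trans (cong (λ m → rad (m * suc n)) (*-identityˡ n)) (rad-* (coprime-suc n))
  abc : rad n * rad (suc n) < suc n → IsAbcTriple 1 n (suc n)
  abc r<c = (z<s , >-nonZero⁻¹ n , z<s)
          , (1-coprimeTo n , 1-coprimeTo (suc n) , coprime-suc n)
          , refl
          , subst (_< suc n) (sym rad[1*n*c]≡) r<c

proposition2p2 : (c : ℕ) → 1 < c →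
    ((cosocle (c ∸ 1) > rad c) ⇔ (cosocle c > rad (c ∸ 1)))
      × ((cosocle c > rad (c ∸ 1)) ⇔ IsAbcTriple 1 (c ∸ 1) c)
proposition2p2 (suc n) (s≤s (s≤s _)) =
    ⇔.trans (<cosocle⇔rad*< n (rad c)) (⇔.trans R<n⇔R<c (⇔.sym ii⇔R<c))
  , ⇔.trans ii⇔R<c (⇔.sym (isAbcTriple[1,n,1+n]⇔ n))
  where
  c = suc n
  R = rad n * rad c
  R<n⇔R<c : R < n ⇔ R < c
  R<n⇔R<c = mk⇔ m<n⇒m<1+n (λ R<c → ≤∧≢⇒< (≤-pred R<c) (rad*rad[1+n]≢n n))
  ii⇔R<c : rad n < cosocle c ⇔ R < c
  ii⇔R<c = subst (λ m → rad n < cosocle c ⇔ m < c) (*-comm (rad c) (rad n)) (<cosocle⇔rad*< c (rad n))
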